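{- Let $n\geq 1$ and $m\geq 3$ be integers with $m\leq 2n+2$. Let $G$ be a graph on $2n+3$ vertices such that $G$ contains no copy of $\mathbb{K}_{2,n}$ and the complement $\bar G$ contains no copy of $C_{m}$. Then $\Delta(G)<2n+2$.
   Context: All graphs are finite and simple. $\Delta(G)$ denotes the maximum degree of $G$ and $\bar G$ the complement of $G$. $\mathbb{K}_{2,n}$ is the complete bipartite graph with parts of sizes $2$ and $n$, and $C_m$ is the cycle on $m$ vertices. -}

module Defs where

open import Data.Nat using (ℕ; suc; _+_; _<_; _%_; _≡ᵇ_; _<ᵇ_; NonZero)
open import Data.Bool using (Bool; true; false; not; _∧_; _∨_; _xor_)
open import Data.Fin using (Fin; toℕ; _≟_)
open import Data.List using (length; filter; allFin)
open import Data.Bool.Properties using () renaming (_≟_ to _≟B_)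
open import Data.Product using (Σ; _×_)
open import Relation.Binary.PropositionalEquality using (_≡_)
open import Relation.Nullary.Decidable using (⌊_⌋)
open import Function.Definitions using (Injective)

Adj : ℕ → Set
Adj N = Fin N → Fin N → Bool

record Graph (N : ℕ) : Set where
  field
    adj    : Adj N
    sym    : ∀ u v → adj u v ≡ adj v u
    irrefl : ∀ v → adj v v ≡ false
open Graph public

degree : ∀ {N} → Graph N → Fin N → ℕ
degree G v = length (filter (λ u → adj G v u ≟B true) (allFin _))

MaxDegreeLess : ∀ {N} → Graph N → ℕ → Set
MaxDegreeLess G d = ∀ v → degree G v < d

complementAdj : ∀ {N} → Graph N → Adj N
complementAdj G u v = not (adj G u v) ∧ not ⌊ u ≟ v ⌋

-- "the graph with adjacency A contains a copy of the graph with adjacency H":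
-- an injective vertex map sending edges of H to edges (not necessarily induced).
ContainsCopy : ∀ {k N} → Adj k → Adj N → Set
ContainsCopy {k} {N} H A =
  Σ (Fin k → Fin N) λ f →
    Injective _≡_ _≡_ f × (∀ i j → H i j ≡ true → A (f i) (f j) ≡ true)

-- The complete bipartite graph K_{2,n} on Fin (2 + n):
-- vertices with toℕ < 2 form the part of size 2, the rest the part of size n.
K2,_ : (n : ℕ) → Adj (2 + n)
(K2, n) u v = (toℕ u <ᵇ 2) xor (toℕ v <ᵇ 2)

-- The cycle C_m on Fin m (used for m ≥ 3):
-- i ~ j iff j ≡ i+1 (mod m) or i ≡ j+1 (mod m).
-- (j = i+1, or i = m-1 and j = 0; symmetrically.)
succMod : (m : ℕ) → Fin m → Fin m → Bool
succMod m i j = (suc (toℕ i) ≡ᵇ toℕ j) ∨ ((suc (toℕ i) ≡ᵇ m) ∧ (toℕ j ≡ᵇ 0))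

C : (m : ℕ) → Adj m
C m i j = succMod m i j ∨ succMod m j i

module Submission where

-- If some vertex v had degree 2n + 2, it would be adjacent to every other vertex. A vertex u ≠ v
-- with n + 1 neighbours would then share n of them with v, giving a copy of K_{2,n}; so all other
-- vertices have degree at most n, and in the complement of G − v, a graph on 2n + 2 vertices,
-- every vertex has degree at least n + 2, more than half the order. Such a graph is pancyclic:
-- Pósa's rotation argument (as in Dirac's theorem) gives a Hamiltonian cycle, and Bondy's count of
-- the neighbours of two consecutive vertices along it gives a cycle of every length 3 … 2n + 2,
-- in particular a copy of C_m in the complement of G.

open import Defs renaming (sym to adj-sym; irrefl to adj-irrefl)
open import Data.Bool using (Bool; true; false; not; _∧_; T)
open import Data.Bool.Properties using (T-≡; T-not-≡; T-∨; T-∧; ∧-zeroʳ; ∧-identityʳ) renaming (_≟_ to _≟B_)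
open import Data.Empty using (⊥; ⊥-elim)
open import Data.Fin using (Fin; zero; suc; toℕ; fromℕ<; punchIn; punchOut; inject≤; _≟_)
open import Data.Fin.Properties
  using (any?; injective⇒≤; punchInᵢ≢i; punchIn-injective; punchIn-punchOut; inject≤-injective;
         toℕ-fromℕ<; toℕ-injective; toℕ≤pred[n]; toℕ<n)
  renaming (suc-injective to fsuc-injective)
open import Data.List using (length; filter; tabulate)
open import Data.Nat using (ℕ; zero; suc; pred; _+_; _*_; _∸_; _≤_; _<_; z≤n; s≤s; s≤s⁻¹; s<s⁻¹; _≤?_; _<?_)
open import Data.Nat.Properties hiding (_≟_)
open import Algebra.Properties.CommutativeSemigroup +-commutativeSemigroup using (interchange; x∙yz≈y∙xz)
open import Data.Nat.Tactic.RingSolver using (solve-∀)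
open import Data.Product using (Σ; ∃; _×_; _,_; proj₁; proj₂)
import Data.Product as Σ
open import Data.Sum using (_⊎_; inj₁; inj₂; [_,_])
open import Function using (_∘_; id)
open import Function.Bundles using (Equivalence)
open import Function.Definitions using (Injective)
open import Relation.Binary.PropositionalEquality hiding ([_])
open import Relation.Nullary using (¬_; Dec; yes; no; contradiction)
open import Relation.Nullary.Decidable
  using (⌊_⌋; map′; isYes; toWitness; fromWitness; fromWitnessFalse; toWitnessFalse; _×-dec_; ¬?; decidable-stable)

-- Counting subsets of Fin N

⌊≟⌋-diag : ∀ {N} (v : Fin N) → ⌊ v ≟ v ⌋ ≡ true
⌊≟⌋-diag v = Equivalence.to T-≡ (fromWitness refl)

⌊≟⌋-≢ : ∀ {N} {u v : Fin N} → u ≢ v → ⌊ u ≟ v ⌋ ≡ false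
⌊≟⌋-≢ u≢v = Equivalence.to T-not-≡ (fromWitnessFalse u≢v)

⌊≟⌋-sym : ∀ {N} (u v : Fin N) → ⌊ u ≟ v ⌋ ≡ ⌊ v ≟ u ⌋
⌊≟⌋-sym u v with u ≟ v
... | yes refl = sym (⌊≟⌋-diag u)
... | no  u≢v  = sym (⌊≟⌋-≢ (u≢v ∘ sym))

fromBool : Bool → ℕ
fromBool true  = 1
fromBool false = 0

fromBool≤1 : ∀ b → fromBool b ≤ 1
fromBool≤1 true  = s≤s z≤n
fromBool≤1 false = z≤n

fromBool+fromBool≤1 : ∀ a b → a ≡ false ⊎ b ≡ false → fromBool a + fromBool b ≤ 1
fromBool+fromBool≤1 false b     _ = fromBool≤1 b
fromBool+fromBool≤1 true  false _ = ≤-refl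
fromBool+fromBool≤1 true  true  (inj₁ ())
fromBool+fromBool≤1 true  true  (inj₂ ())

fromBool+fromBool-not : ∀ b → fromBool b + fromBool (not b) ≡ 1
fromBool+fromBool-not true  = refl
fromBool+fromBool-not false = refl

count : ∀ {N} → (Fin N → Bool) → ℕ
count {zero}  p = 0
count {suc N} p = fromBool (p zero) + count (p ∘ suc)

count-cong : ∀ {N} {p q : Fin N → Bool} → (∀ i → p i ≡ q i) → count p ≡ count q
count-cong {zero}  p≗q = refl
count-cong {suc N} p≗q = cong₂ _+_ (cong fromBool (p≗q zero)) (count-cong (p≗q ∘ suc))

count≤ : ∀ {N} (p : Fin N → Bool) → count p ≤ N
count≤ {zero}  p = z≤n
count≤ {suc N} p = +-mono-≤ (fromBool≤1 (p zero)) (count≤ (p ∘ suc))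

count-true : ∀ N → count {N} (λ _ → true) ≡ N
count-true zero    = refl
count-true (suc N) = cong suc (count-true N)

count+count-not : ∀ {N} (p : Fin N → Bool) → count p + count (not ∘ p) ≡ N
count+count-not {zero}  p = refl
count+count-not {suc N} p =
  trans (interchange (fromBool (p zero)) _ _ _)
        (cong₂ _+_ (fromBool+fromBool-not (p zero)) (count+count-not (p ∘ suc)))

count-punchIn : ∀ {N} (p : Fin (suc N) → Bool) (v : Fin (suc N)) →
  count p ≡ fromBool (p v) + count (p ∘ punchIn v)
count-punchIn p zero = refl
count-punchIn {suc N} p (suc v) =
  trans (cong (fromBool (p zero) +_) (count-punchIn (p ∘ suc) v))
        (x∙yz≈y∙xz (fromBool (p zero)) (fromBool (p (suc v))) _)

count-punchIn-false : ∀ {N} (p : Fin (suc N) → Bool) {v} → p v ≡ false → count p ≡ count (p ∘ punchIn v)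
count-punchIn-false p {v} pv≡false =
  trans (count-punchIn p v) (cong (λ b → fromBool b + count (p ∘ punchIn v)) pv≡false)

count<-if-false : ∀ {N} (p : Fin N → Bool) (w : Fin N) → p w ≡ false → count p < N
count<-if-false {suc N} p w pw≡false =
  ≤-trans (≤-reflexive (cong suc (count-punchIn-false p pw≡false))) (s≤s (count≤ (p ∘ punchIn w)))

common-true : ∀ {N} (p q : Fin N → Bool) → N < count p + count q → ∃ λ i → p i ≡ true × q i ≡ true
common-true {suc N} p q big with p zero in p0 | q zero in q0
... | true  | true  = zero , p0 , q0
... | true  | false = Σ.map suc id (common-true (p ∘ suc) (q ∘ suc) (≤-pred big))
... | false | true  =
  Σ.map suc id (common-true (p ∘ suc) (q ∘ suc) (≤-pred (≤-trans big (≤-reflexive (+-suc (count (p ∘ suc)) _)))))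
... | false | false = Σ.map suc id (common-true (p ∘ suc) (q ∘ suc) (<⇒≤ big))

record Enumeration {N} (p : Fin N → Bool) (c : ℕ) : Set where
  field
    at        : Fin c → Fin N
    injective : Injective _≡_ _≡_ at
    sound     : ∀ j → p (at j) ≡ true
    complete  : ∀ i → p i ≡ true → ∃ λ j → at j ≡ i

enumerate : ∀ {N} (p : Fin N → Bool) → Enumeration p (count p)
enumerate {zero} p = record { at = λ () ; injective = λ {} ; sound = λ () ; complete = λ () }
enumerate {suc N} p with p zero in p0 | enumerate (p ∘ suc)
... | true | E = record
  { at        = at′
  ; injective = injective′
  ; sound     = λ { zero → p0 ; (suc j) → sound j }
  ; complete  = λ { zero _ → zero , refl ; (suc i) pi → Σ.map suc (cong suc) (complete i pi) }
  }
  where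
  open Enumeration E
  at′ : Fin (suc (count (p ∘ suc))) → Fin (suc N)
  at′ zero    = zero
  at′ (suc j) = suc (at j)
  injective′ : Injective _≡_ _≡_ at′
  injective′ {zero}  {zero}  _  = refl
  injective′ {suc i} {suc j} eq = cong suc (injective (fsuc-injective eq))
... | false | E = record
  { at        = suc ∘ at
  ; injective = injective ∘ fsuc-injective
  ; sound     = sound
  ; complete  = λ { zero pi → contradiction (trans (sym p0) pi) λ () ; (suc i) pi → Σ.map id (cong suc) (complete i pi) }
  }
  where open Enumeration E

count-injection : ∀ {a b} (p : Fin a → Bool) (q : Fin b → Bool) (g : ∀ i → p i ≡ true → Fin b) →
  (∀ i pi → q (g i pi) ≡ true) → (∀ i j pi pj → g i pi ≡ g j pj → i ≡ j) → count p ≤ count q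
count-injection p q g g-sound g-injective = injective⇒≤ {f = h} h-injective
  where
  module P = Enumeration (enumerate p)
  module Q = Enumeration (enumerate q)
  h : Fin (count p) → Fin (count q)
  h j = proj₁ (Q.complete (g (P.at j) (P.sound j)) (g-sound _ _))
  h-correct : ∀ j → Q.at (h j) ≡ g (P.at j) (P.sound j)
  h-correct j = proj₂ (Q.complete (g (P.at j) (P.sound j)) (g-sound _ _))
  h-injective : Injective _≡_ _≡_ h
  h-injective {i} {j} eq =
    P.injective (g-injective _ _ _ _ (trans (sym (h-correct i)) (trans (cong Q.at eq) (h-correct j))))

count< : ℕ → (ℕ → Bool) → ℕ
count< n p = count {n} (p ∘ toℕ)

count<-+ : ∀ a b (p : ℕ → Bool) → count< (a + b) p ≡ count< a p + count< b (p ∘ (a +_))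
count<-+ zero    b p = refl
count<-+ (suc a) b p =
  trans (cong (fromBool (p 0) +_) (count<-+ a b (p ∘ suc))) (sym (+-assoc (fromBool (p 0)) _ _))

count-covered : ∀ {N} K (q : Fin N → Bool) (g : ℕ → Fin N) →
  (∀ w → q w ≡ true → ∃ λ i → i < K × g i ≡ w) → count q ≤ count< K (q ∘ g)
count-covered K q g cover = count-injection q (q ∘ g ∘ toℕ) position position-sound position-injective
  where
  position : ∀ w → q w ≡ true → Fin K
  position w qw = fromℕ< (proj₁ (proj₂ (cover w qw)))
  position-correct : ∀ w qw → g (toℕ (position w qw)) ≡ w
  position-correct w qw = trans (cong g (toℕ-fromℕ< _)) (proj₂ (proj₂ (cover w qw)))
  position-sound : ∀ w qw → q (g (toℕ (position w qw))) ≡ true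
  position-sound w qw = trans (cong q (position-correct w qw)) qw
  position-injective : ∀ w w′ qw qw′ → position w qw ≡ position w′ qw′ → w ≡ w′
  position-injective w w′ qw qw′ eq =
    trans (sym (position-correct w qw)) (trans (cong (g ∘ toℕ) eq) (position-correct w′ qw′))

count<-drop-two : ∀ n (p : ℕ → Bool) → p 0 ≡ false ⊎ p 1 ≡ false →
  count< (2 + n) p ≤ 1 + count< n (p ∘ (2 +_))
count<-drop-two n p not-both =
  ≤-trans (≤-reflexive (sym (+-assoc (fromBool (p 0)) (fromBool (p 1)) _)))
          (+-monoˡ-≤ _ (fromBool+fromBool≤1 (p 0) (p 1) not-both))

<-+-split : ∀ {m n} a b c d → m + n < (a + b) + (c + d) → m < a + c ⊎ n < b + d
<-+-split {m} {n} a b c d m+n< with m <? a + c | n <? b + d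
... | yes m< | _      = inj₁ m<
... | no _   | yes n< = inj₂ n<
... | no m≮  | no n≮  = contradiction m+n< (≤⇒≯ (begin
  (a + b) + (c + d)  ≡⟨ interchange a b c d ⟩
  (a + c) + (b + d)  ≤⟨ +-mono-≤ (≮⇒≥ m≮) (≮⇒≥ n≮) ⟩
  m + n              ∎))
  where open ≤-Reasoning

count≥⇒all : ∀ {N} (p : Fin N → Bool) → N ≤ count p → ∀ i → p i ≡ true
count≥⇒all p N≤count i with p i in pi
... | true  = refl
... | false = contradiction N≤count (<⇒≱ (count<-if-false p i pi))

count≤1+count-without : ∀ {N} (p : Fin (suc N) → Bool) (v : Fin (suc N)) →
  count p ≤ 1 + count (λ w → p w ∧ not ⌊ w ≟ v ⌋)
count≤1+count-without {N} p v = begin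
  count p                                  ≡⟨ count-punchIn p v ⟩
  fromBool (p v) + count (p ∘ punchIn v)   ≤⟨ +-mono-≤ (fromBool≤1 (p v)) (≤-reflexive (count-cong off-v)) ⟩
  1 + count (q ∘ punchIn v)                ≤⟨ +-monoʳ-≤ 1 (m≤n+m _ (fromBool (q v))) ⟩
  1 + (fromBool (q v) + count (q ∘ punchIn v)) ≡⟨ cong suc (count-punchIn q v) ⟨
  1 + count q                              ∎
  where
  open ≤-Reasoning
  q : Fin (suc N) → Bool
  q w = p w ∧ not ⌊ w ≟ v ⌋
  off-v : ∀ t → p (punchIn v t) ≡ q (punchIn v t)
  off-v t = sym (trans (cong (λ b → p (punchIn v t) ∧ not b) (⌊≟⌋-≢ (punchInᵢ≢i v t))) (∧-identityʳ _))

-- Degrees, complements and deleted vertices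

degree≡count : ∀ {N} (G : Graph N) v → degree G v ≡ count (adj G v)
degree≡count G v = length-filter (adj G v) id
  where
  length-filter : ∀ {N} {A : Set} (p : A → Bool) (f : Fin N → A) →
    length (filter (λ u → p u ≟B true) (tabulate f)) ≡ count (p ∘ f)
  length-filter {zero}  p f = refl
  length-filter {suc N} p f with p (f zero)
  ... | true  = cong suc (length-filter p (f ∘ suc))
  ... | false = length-filter p (f ∘ suc)

complement : ∀ {N} → Graph N → Graph N
complement G = record
  { adj    = complementAdj G
  ; sym    = λ u v → cong₂ (λ a b → not a ∧ not b) (adj-sym G u v) (⌊≟⌋-sym u v)
  ; irrefl = λ v → trans (cong (λ b → not (adj G v v) ∧ not b) (⌊≟⌋-diag v)) (∧-zeroʳ _)
  }

count-adj+count-complement : ∀ {N} (G : Graph (suc N)) u → count (adj G u) + count (complementAdj G u) ≡ N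
count-adj+count-complement G u = begin
  count (adj G u) + count (complementAdj G u)
    ≡⟨ cong₂ _+_ (count-punchIn-false (adj G u) (adj-irrefl G u))
                 (count-punchIn-false (complementAdj G u) (adj-irrefl (complement G) u)) ⟩
  count (adj G u ∘ punchIn u) + count (complementAdj G u ∘ punchIn u)
    ≡⟨ cong (count (adj G u ∘ punchIn u) +_) (count-cong off-diagonal) ⟩
  count (adj G u ∘ punchIn u) + count (not ∘ adj G u ∘ punchIn u)
    ≡⟨ count+count-not (adj G u ∘ punchIn u) ⟩
  _ ∎
  where
  open ≡-Reasoning
  off-diagonal : ∀ t → complementAdj G u (punchIn u t) ≡ not (adj G u (punchIn u t))
  off-diagonal t =
    trans (cong (λ b → not (adj G u (punchIn u t)) ∧ not b) (⌊≟⌋-≢ (punchInᵢ≢i u t ∘ sym))) (∧-identityʳ _)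

delete : ∀ {N} → Fin (suc N) → Graph (suc N) → Graph N
delete v G = record
  { adj    = λ u w → adj G (punchIn v u) (punchIn v w)
  ; sym    = λ u w → adj-sym G (punchIn v u) (punchIn v w)
  ; irrefl = λ u → adj-irrefl G (punchIn v u)
  }

delete-copy : ∀ {k N} {H : Adj k} (v : Fin (suc N)) (G : Graph (suc N)) →
  ContainsCopy H (adj (delete v G)) → ContainsCopy H (adj G)
delete-copy v G (f , f-injective , f-edges) = punchIn v ∘ f , f-injective ∘ punchIn-injective v _ _ , f-edges

common-neighbours⇒K2, : ∀ {N n} (G : Graph N) {u v} (q : Fin N → Bool) → u ≢ v → n ≤ count q →
  (∀ w → q w ≡ true → adj G u w ≡ true × adj G v w ≡ true) → ContainsCopy (K2, n) (adj G)
common-neighbours⇒K2, {N} {n} G {u} {v} q u≢v n≤count common = f , f-injective , f-edges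
  where
  open Enumeration (enumerate q)
  neighbour : Fin n → Fin N
  neighbour j = at (inject≤ j n≤count)
  u~ : ∀ j → adj G u (neighbour j) ≡ true
  u~ j = proj₁ (common _ (sound _))
  v~ : ∀ j → adj G v (neighbour j) ≡ true
  v~ j = proj₂ (common _ (sound _))
  adjacent⇒≢ : ∀ {x y} → adj G x y ≡ true → x ≢ y
  adjacent⇒≢ {x} x~y refl with () ← trans (sym x~y) (adj-irrefl G x)
  f : Fin (2 + n) → Fin N
  f zero             = u
  f (suc zero)       = v
  f (suc (suc j))    = neighbour j
  f-injective : Injective _≡_ _≡_ f
  f-injective {zero}          {zero}           _  = refl
  f-injective {zero}          {suc zero}       eq = contradiction eq u≢v
  f-injective {zero}          {suc (suc j)}    eq = contradiction eq (adjacent⇒≢ (u~ j))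
  f-injective {suc zero}      {zero}           eq = contradiction (sym eq) u≢v
  f-injective {suc zero}      {suc zero}       _  = refl
  f-injective {suc zero}      {suc (suc j)}    eq = contradiction eq (adjacent⇒≢ (v~ j))
  f-injective {suc (suc i)}   {zero}           eq = contradiction (sym eq) (adjacent⇒≢ (u~ i))
  f-injective {suc (suc i)}   {suc zero}       eq = contradiction (sym eq) (adjacent⇒≢ (v~ i))
  f-injective {suc (suc i)}   {suc (suc j)}    eq =
    cong {A = Fin n} (λ j → suc (suc j)) (inject≤-injective n≤count n≤count i j (injective eq))
  f-edges : ∀ i j → (K2, n) i j ≡ true → adj G (f i) (f j) ≡ true
  f-edges zero          (suc (suc j)) _ = u~ j
  f-edges (suc zero)    (suc (suc j)) _ = v~ j
  f-edges (suc (suc i)) zero          _ = trans (adj-sym G _ u) (u~ i)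
  f-edges (suc (suc i)) (suc zero)    _ = trans (adj-sym G _ v) (v~ i)

full-degree⇒adjacent-to-all : ∀ {N} (G : Graph (suc N)) v → N ≤ count (adj G v) →
  ∀ w → w ≢ v → adj G v w ≡ true
full-degree⇒adjacent-to-all {N} G v N≤count w w≢v =
  subst (λ x → adj G v x ≡ true) (punchIn-punchOut (w≢v ∘ sym))
        (count≥⇒all (adj G v ∘ punchIn v) N≤count′ (punchOut (w≢v ∘ sym)))
  where
  N≤count′ : N ≤ count (adj G v ∘ punchIn v)
  N≤count′ = ≤-trans N≤count (≤-reflexive (count-punchIn-false (adj G v) (adj-irrefl G v)))

K2,-free⇒low-degree : ∀ {N n} (G : Graph (suc N)) (v : Fin (suc N)) → (∀ w → w ≢ v → adj G v w ≡ true) →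
  ¬ ContainsCopy (K2, n) (adj G) → ∀ u → u ≢ v → count (adj G u) ≤ n
K2,-free⇒low-degree {N} {n} G v universal no-K u u≢v with count (adj G u) ≤? n
... | yes low  = low
... | no  high = contradiction (common-neighbours⇒K2, G q u≢v n≤count common) no-K
  where
  q : Fin (suc N) → Bool
  q w = adj G u w ∧ not ⌊ w ≟ v ⌋
  n≤count : n ≤ count q
  n≤count = s≤s⁻¹ (≤-trans (≰⇒> high) (count≤1+count-without (adj G u) v))
  common : ∀ w → q w ≡ true → adj G u w ≡ true × adj G v w ≡ true
  common w qw with u~w , w≢v ← Equivalence.to T-∧ (Equivalence.from T-≡ qw) =
    Equivalence.to T-≡ u~w , universal w (toWitnessFalse w≢v)

-- Paths and cycles

glue : ∀ {A : Set} → ℕ → (ℕ → A) → (ℕ → A) → ℕ → A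
glue zero    f g zero    = f 0
glue zero    f g (suc t) = g t
glue (suc a) f g zero    = f 0
glue (suc a) f g (suc t) = glue a (f ∘ suc) g t

glue-left : ∀ {A : Set} a (f g : ℕ → A) {t} → t ≤ a → glue a f g t ≡ f t
glue-left zero    f g z≤n       = refl
glue-left (suc a) f g z≤n       = refl
glue-left (suc a) f g (s≤s t≤a) = glue-left a (f ∘ suc) g t≤a

glue-right : ∀ {A : Set} a (f g : ℕ → A) u → glue a f g (suc a + u) ≡ g u
glue-right zero    f g u = refl
glue-right (suc a) f g u = glue-right a (f ∘ suc) g u

split-at : ∀ a t → t ≤ a ⊎ ∃ λ u → t ≡ suc a + u
split-at a t with t ≤? a
... | yes t≤a = inj₁ t≤a
... | no  t≰a = inj₂ (t ∸ suc a , sym (m+[n∸m]≡n (≰⇒> t≰a)))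

right-bound : ∀ a {b u} → suc a + u ≤ a + suc b → u ≤ b
right-bound a {b} {u} le = +-cancelˡ-≤ (suc a) u b (≤-trans le (≤-reflexive (+-suc a b)))

module Paths {M : ℕ} (G : Graph M) where

  Vertex : Set
  Vertex = Fin M

  _~_ : Vertex → Vertex → Set
  u ~ v = adj G u v ≡ true

  ~-sym : ∀ {u v} → u ~ v → v ~ u
  ~-sym {u} {v} u~v = trans (adj-sym G v u) u~v

  ~-irrefl : ∀ {v} → ¬ v ~ v
  ~-irrefl {v} v~v with () ← trans (sym v~v) (adj-irrefl G v)

  -- A path of length ℓ has the ℓ + 1 vertices vertex 0, …, vertex ℓ.
  record Path (ℓ : ℕ) : Set where
    field
      vertex    : ℕ → Vertex
      injective : ∀ {i j} → i ≤ ℓ → j ≤ ℓ → vertex i ≡ vertex j → i ≡ j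
      adjacent  : ∀ {i} → i < ℓ → vertex i ~ vertex (suc i)

    first : Vertex
    first = vertex 0

    last : Vertex
    last = vertex ℓ
  open Path public

  variable
    ℓ a b n : ℕ
    w : Vertex

  _∈ₚ_ : Vertex → Path ℓ → Set
  _∈ₚ_ {ℓ} w P = ∃ λ k → k ≤ ℓ × vertex P k ≡ w

  Visits : Path ℓ → ℕ → ℕ → Vertex → Set
  Visits P a b w = ∃ λ k → a ≤ k × k ≤ b × vertex P k ≡ w

  Disjoint : Path a → Path b → Set
  Disjoint P Q = ∀ {w} → w ∈ₚ P → w ∈ₚ Q → ⊥

  Spanning : Path ℓ → Set
  Spanning P = ∀ w → w ∈ₚ P

  _∈ₚ?_ : (w : Vertex) (P : Path ℓ) → Dec (w ∈ₚ P)
  _∈ₚ?_ {ℓ} w P = map′ (Σ.map₂ (Σ.map₁ s≤s⁻¹)) (Σ.map₂ (Σ.map₁ s≤s))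
                       (anyUpTo? (λ k → vertex P k ≟ w) (suc ℓ))

  visits-disjoint : (P : Path ℓ) → b < a → n ≤ ℓ → ∀ {c} → Visits P c b w → Visits P a n w → ⊥
  visits-disjoint {ℓ = ℓ} P b<a n≤ℓ (i , _ , i≤b , Pi≡w) (j , a≤j , j≤n , Pj≡w) =
    <⇒≢ i<j (injective P (<⇒≤ (<-≤-trans i<j j≤ℓ)) j≤ℓ (trans Pi≡w (sym Pj≡w)))
    where
    i<j : i < j
    i<j = ≤-<-trans i≤b (<-≤-trans b<a a≤j)
    j≤ℓ : j ≤ ℓ
    j≤ℓ = ≤-trans j≤n n≤ℓ

  visits⇒∈ : (P : Path ℓ) → n ≤ ℓ → ∀ {c} → Visits P c n w → w ∈ₚ P
  visits⇒∈ P n≤ℓ (k , _ , k≤n , eq) = k , ≤-trans k≤n n≤ℓ , eq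

  cast : a ≡ b → Path a → Path b
  cast {a = a} {b = b} a≡b P = record
    { vertex    = vertex P
    ; injective = λ i≤b j≤b → injective P (≤-trans i≤b b≤a) (≤-trans j≤b b≤a)
    ; adjacent  = λ i<b → adjacent P (<-≤-trans i<b b≤a)
    }
    where
    b≤a : b ≤ a
    b≤a = ≤-reflexive (sym a≡b)

  cast-last : (a≡b : a ≡ b) (P : Path a) → last (cast a≡b P) ≡ last P
  cast-last a≡b P = cong (vertex P) (sym a≡b)

  cast-∈ : (a≡b : a ≡ b) (P : Path a) → w ∈ₚ cast a≡b P → w ∈ₚ P
  cast-∈ a≡b P (k , k≤b , eq) = k , ≤-trans k≤b (≤-reflexive (sym a≡b)) , eq

  singleton : Vertex → Path 0
  singleton v = record
    { vertex    = λ _ → v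
    ; injective = λ { z≤n z≤n _ → refl }
    ; adjacent  = λ ()
    }

  singleton-∈ : ∀ {v} → w ∈ₚ singleton v → v ≡ w
  singleton-∈ (_ , _ , v≡w) = v≡w

  subpath : (P : Path ℓ) (a : ℕ) → a + n ≤ ℓ → Path n
  subpath {ℓ = ℓ} {n = n} P a a+n≤ℓ = record
    { vertex    = λ t → vertex P (a + t)
    ; injective = λ i≤n j≤n eq → +-cancelˡ-≡ a _ _ (injective P (inside i≤n) (inside j≤n) eq)
    ; adjacent  = λ {i} i<n →
        subst (λ k → vertex P (a + i) ~ vertex P k) (sym (+-suc a i)) (adjacent P (<-≤-trans (+-monoʳ-< a i<n) a+n≤ℓ))
    }
    where
    inside : ∀ {t} → t ≤ n → a + t ≤ ℓ
    inside t≤n = ≤-trans (+-monoʳ-≤ a t≤n) a+n≤ℓ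

  subpath-∈ : (P : Path ℓ) (a : ℕ) (a+n≤ℓ : a + n ≤ ℓ) → w ∈ₚ subpath P a a+n≤ℓ → Visits P a (a + n) w
  subpath-∈ P a _ (k , k≤n , eq) = a + k , m≤m+n a k , +-monoʳ-≤ a k≤n , eq

  reverse : Path ℓ → Path ℓ
  reverse {ℓ = ℓ} P = record
    { vertex    = λ t → vertex P (ℓ ∸ t)
    ; injective = λ {i} {j} i≤ℓ j≤ℓ eq → ∸-cancelˡ-≡ i≤ℓ j≤ℓ (injective P (m∸n≤m ℓ i) (m∸n≤m ℓ j) eq)
    ; adjacent  = λ {i} i<ℓ →
        subst (λ k → vertex P k ~ vertex P (ℓ ∸ suc i)) (sym (+-∸-assoc 1 i<ℓ))
              (~-sym (adjacent P (∸-monoʳ-< (s≤s z≤n) i<ℓ)))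
    }

  reverse-last : (P : Path ℓ) → last (reverse P) ≡ first P
  reverse-last {ℓ = ℓ} P = cong (vertex P) (n∸n≡0 ℓ)

  reverse-∈ : (P : Path ℓ) → w ∈ₚ reverse P → w ∈ₚ P
  reverse-∈ {ℓ = ℓ} P (k , _ , eq) = ℓ ∸ k , m∸n≤m ℓ k , eq

  join : (P : Path a) (Q : Path b) → last P ~ first Q → Disjoint P Q → Path (a + suc b)
  join {a = a} {b = b} P Q edge disjoint = record
    { vertex    = h
    ; injective = injective′
    ; adjacent  = adjacent′
    }
    where
    h : ℕ → Vertex
    h = glue a (vertex P) (vertex Q)
    left : ∀ {i} → i ≤ a → h i ≡ vertex P i
    left = glue-left a (vertex P) (vertex Q)
    right : ∀ u → h (suc a + u) ≡ vertex Q u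
    right = glue-right a (vertex P) (vertex Q)
    injective′ : ∀ {i j} → i ≤ a + suc b → j ≤ a + suc b → h i ≡ h j → i ≡ j
    injective′ {i} {j} i≤ j≤ eq with split-at a i | split-at a j
    ... | inj₁ i≤a        | inj₁ j≤a         = injective P i≤a j≤a (trans (sym (left i≤a)) (trans eq (left j≤a)))
    ... | inj₁ i≤a        | inj₂ (u , refl)  =
      ⊥-elim (disjoint (i , i≤a , refl) (u , right-bound a j≤ , trans (sym (right u)) (trans (sym eq) (left i≤a))))
    ... | inj₂ (u , refl) | inj₁ j≤a         =
      ⊥-elim (disjoint (j , j≤a , refl) (u , right-bound a i≤ , trans (sym (right u)) (trans eq (left j≤a))))
    ... | inj₂ (u , refl) | inj₂ (u′ , refl) =
      cong (suc a +_) (injective Q (right-bound a i≤) (right-bound a j≤) (trans (sym (right u)) (trans eq (right u′))))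
    adjacent′ : ∀ {i} → i < a + suc b → h i ~ h (suc i)
    adjacent′ {i} i< with split-at a i
    ... | inj₂ (u , refl) =
      subst₂ _~_ (sym (right u)) (sym (trans (cong h (sym (+-suc (suc a) u))) (right (suc u))))
             (adjacent Q (right-bound a (≤-trans (≤-reflexive (+-suc (suc a) u)) i<)))
    ... | inj₁ i≤a with m≤n⇒m<n∨m≡n i≤a
    ...   | inj₁ i<a  = subst₂ _~_ (sym (left i≤a)) (sym (left i<a)) (adjacent P i<a)
    ...   | inj₂ refl = subst₂ _~_ (sym (left ≤-refl)) (sym (trans (cong h (sym (+-identityʳ (suc a)))) (right 0))) edge

  join-first : (P : Path a) (Q : Path b) (e : last P ~ first Q) (d : Disjoint P Q) → first (join P Q e d) ≡ first P
  join-first {a = a} P Q _ _ = glue-left a (vertex P) (vertex Q) z≤n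

  join-last : (P : Path a) (Q : Path b) (e : last P ~ first Q) (d : Disjoint P Q) → last (join P Q e d) ≡ last Q
  join-last {a = a} {b = b} P Q _ _ =
    trans (cong (glue a (vertex P) (vertex Q)) (+-suc a b)) (glue-right a (vertex P) (vertex Q) b)

  join-∈ : (P : Path a) (Q : Path b) (e : last P ~ first Q) (d : Disjoint P Q) → w ∈ₚ join P Q e d → w ∈ₚ P ⊎ w ∈ₚ Q
  join-∈ {a = a} P Q _ _ (k , k≤ , eq) with split-at a k
  ... | inj₁ k≤a       = inj₁ (k , k≤a , trans (sym (glue-left a (vertex P) (vertex Q) k≤a)) eq)
  ... | inj₂ (u , refl) = inj₂ (u , right-bound a k≤ , trans (sym (glue-right a (vertex P) (vertex Q) u)) eq)

  vertices : Path ℓ → Vertex → Bool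
  vertices P w = isYes (w ∈ₚ? P)

  vertices-sound : (P : Path ℓ) → vertices P w ≡ true → w ∈ₚ P
  vertices-sound P = toWitness ∘ Equivalence.from T-≡

  vertices-complete : (P : Path ℓ) → w ∈ₚ P → vertices P w ≡ true
  vertices-complete P = Equivalence.to T-≡ ∘ fromWitness

  count-vertices : (P : Path ℓ) → suc ℓ ≤ count (vertices P)
  count-vertices {ℓ = ℓ} P =
    subst (_≤ count (vertices P)) (count-true (suc ℓ))
      (count-injection (λ _ → true) (vertices P) (λ i _ → vertex P (toℕ i))
        (λ i _ → vertices-complete P (toℕ i , toℕ≤pred[n] i , refl))
        (λ i j _ _ eq → toℕ-injective (injective P (toℕ≤pred[n] i) (toℕ≤pred[n] j) eq)))

  length<M : Path ℓ → ℓ < M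
  length<M P = ≤-trans (count-vertices P) (count≤ (vertices P))

  spanning⇒M≤ : (P : Path ℓ) → Spanning P → M ≤ suc ℓ
  spanning⇒M≤ {ℓ = ℓ} P spanning = begin
    M                                       ≡⟨ count-true M ⟨
    count {M} (λ _ → true)                  ≤⟨ count-covered (suc ℓ) (λ _ → true) (vertex P) cover ⟩
    count< (suc ℓ) (λ _ → true)             ≤⟨ count≤ {suc ℓ} (λ _ → true) ⟩
    suc ℓ                                   ∎
    where
    open ≤-Reasoning
    cover : ∀ w → true ≡ true → ∃ λ i → i < suc ℓ × vertex P i ≡ w
    cover w _ = Σ.map₂ (Σ.map₁ s≤s) (spanning w)

  record Cycle (L : ℕ) : Set where
    field
      path    : Path (pred L)
      closing : last path ~ first path
  open Cycle public

  cycle⇒copy : ∀ {L} → Cycle L → ContainsCopy (C L) (adj G)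
  cycle⇒copy {L} c = vertex P ∘ toℕ , injective′ , edge
    where
    P : Path (pred L)
    P = path c
    injective′ : Injective _≡_ _≡_ (vertex P ∘ toℕ)
    injective′ {i} {j} eq = toℕ-injective (injective P (toℕ≤pred[n] i) (toℕ≤pred[n] j) eq)
    successor : ∀ i j → T (succMod L i j) → vertex P (toℕ i) ~ vertex P (toℕ j)
    successor i j s with Equivalence.to T-∨ s
    ... | inj₁ i+1≡j = subst (λ k → vertex P (toℕ i) ~ vertex P k) i+1≡j′
                         (adjacent P (subst (_≤ pred L) (sym i+1≡j′) (toℕ≤pred[n] j)))
      where
      i+1≡j′ : suc (toℕ i) ≡ toℕ j
      i+1≡j′ = ≡ᵇ⇒≡ (suc (toℕ i)) (toℕ j) i+1≡j
    ... | inj₂ wraps with i+1≡L , j≡0 ← Equivalence.to T-∧ wraps =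
      subst₂ _~_ (sym (cong (vertex P ∘ pred) (≡ᵇ⇒≡ (suc (toℕ i)) L i+1≡L)))
                 (sym (cong (vertex P) (≡ᵇ⇒≡ (toℕ j) 0 j≡0)))
                 (closing c)
    edge : ∀ i j → C L i j ≡ true → vertex P (toℕ i) ~ vertex P (toℕ j)
    edge i j e with Equivalence.to T-∨ (Equivalence.from T-≡ e)
    ... | inj₁ s = successor i j s
    ... | inj₂ s = ~-sym (successor j i s)

  -- The cycle P 0 … P i, P ℓ, P (ℓ - 1) … P (i + 1).
  crossing⇒cycle : (P : Path ℓ) (i j : ℕ) → suc i + j ≡ ℓ →
    vertex P i ~ last P → first P ~ vertex P (suc i) → Cycle (suc ℓ)
  crossing⇒cycle {ℓ = ℓ} P i j i+1+j≡ℓ Pi~last first~Pi+1 = record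
    { path    = cast joined-length joined
    ; closing = subst₂ _~_ (sym last-joined) (sym (join-first front back edge disjoint)) (~-sym first~Pi+1)
    }
    where
    i+1+j≤ℓ : suc i + j ≤ ℓ
    i+1+j≤ℓ = ≤-reflexive i+1+j≡ℓ
    i≤ℓ : 0 + i ≤ ℓ
    i≤ℓ = ≤-trans (n≤1+n i) (≤-trans (m≤m+n (suc i) j) i+1+j≤ℓ)
    front : Path i
    front = subpath P 0 i≤ℓ
    back : Path j
    back = reverse (subpath P (suc i) i+1+j≤ℓ)
    last-back : last back ≡ vertex P (suc i)
    last-back = trans (reverse-last (subpath P (suc i) i+1+j≤ℓ)) (cong (vertex P) (+-identityʳ (suc i)))
    edge : last front ~ first back
    edge = subst (vertex P i ~_) (cong (vertex P) (sym i+1+j≡ℓ)) Pi~last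
    disjoint : Disjoint front back
    disjoint w∈front w∈back = visits-disjoint P (n<1+n i) i+1+j≤ℓ
      (subpath-∈ P 0 i≤ℓ w∈front) (subpath-∈ P (suc i) i+1+j≤ℓ (reverse-∈ (subpath P (suc i) i+1+j≤ℓ) w∈back))
    joined : Path (i + suc j)
    joined = join front back edge disjoint
    joined-length : i + suc j ≡ ℓ
    joined-length = trans (+-suc i j) i+1+j≡ℓ
    last-joined : last (cast joined-length joined) ≡ vertex P (suc i)
    last-joined = trans (cast-last joined-length joined) (trans (join-last front back edge disjoint) last-back)

  -- The path P j … P ℓ P 0 … P (j - 1) around the cycle.
  rotate : (c : Cycle (suc ℓ)) (j : ℕ) → j ≤ ℓ →
    Σ (Path ℓ) λ Q → first Q ≡ vertex (path c) j × (∀ {w} → w ∈ₚ Q → w ∈ₚ path c)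
  rotate c zero    _   = path c , refl , id
  rotate {ℓ = ℓ} c (suc j) j<ℓ with (k , j+1+k≡ℓ) ← m≤n⇒∃[o]m+o≡n j<ℓ =
    cast joined-length joined , first-joined , joined⊆P ∘ cast-∈ joined-length joined
    where
    P : Path ℓ
    P = path c
    j+1+k≤ℓ : suc j + k ≤ ℓ
    j+1+k≤ℓ = ≤-reflexive j+1+k≡ℓ
    j≤ℓ : 0 + j ≤ ℓ
    j≤ℓ = <⇒≤ j<ℓ
    back : Path k
    back = subpath P (suc j) j+1+k≤ℓ
    front : Path j
    front = subpath P 0 j≤ℓ
    edge : last back ~ first front
    edge = subst (_~ first P) (cong (vertex P) (sym j+1+k≡ℓ)) (closing c)
    disjoint : Disjoint back front
    disjoint w∈back w∈front = visits-disjoint P (n<1+n j) j+1+k≤ℓ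
      (subpath-∈ P 0 j≤ℓ w∈front) (subpath-∈ P (suc j) j+1+k≤ℓ w∈back)
    joined : Path (k + suc j)
    joined = join back front edge disjoint
    joined-length : k + suc j ≡ ℓ
    joined-length = trans (+-suc k j) (trans (cong suc (+-comm k j)) j+1+k≡ℓ)
    first-joined : first joined ≡ vertex P (suc j)
    first-joined = trans (join-first back front edge disjoint) (cong (vertex P) (+-identityʳ (suc j)))
    joined⊆P : ∀ {w} → w ∈ₚ joined → w ∈ₚ P
    joined⊆P = [ visits⇒∈ P j+1+k≤ℓ ∘ subpath-∈ P (suc j) j+1+k≤ℓ , visits⇒∈ P j≤ℓ ∘ subpath-∈ P 0 j≤ℓ ]
               ∘ join-∈ back front edge disjoint

  extend-end : (P : Path ℓ) → last P ~ w → ¬ w ∈ₚ P → Path (suc ℓ)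
  extend-end {ℓ = ℓ} {w = w} P last~w w∉P =
    cast (+-comm ℓ 1) (join P (singleton w) last~w λ w′∈P w′∈w → w∉P (subst (_∈ₚ P) (sym (singleton-∈ w′∈w)) w′∈P))

  extend-start : (P : Path ℓ) → w ~ first P → ¬ w ∈ₚ P → Path (suc ℓ)
  extend-start {w = w} P w~first w∉P =
    join (singleton w) P w~first λ w′∈w w′∈P → w∉P (subst (_∈ₚ P) (sym (singleton-∈ w′∈w)) w′∈P)

  -- The cycle x y P(2+t) … P(2+t+k) through the edge x y = P 0, P 1.
  chords⇒cycle₁ : (P : Path ℓ) (t k : ℕ) → 2 + t + k ≤ ℓ →
    vertex P 1 ~ vertex P (2 + t) → vertex P (2 + t + k) ~ vertex P 0 → Cycle (3 + k)
  chords⇒cycle₁ {ℓ = ℓ} P t k bound y~P₂₊ₜ P₂₊ₜ₊ₖ~x = record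
    { path    = join edge-xy segment y~segment disjoint
    ; closing = subst₂ _~_ (sym (join-last edge-xy segment y~segment disjoint))
                           (sym (join-first edge-xy segment y~segment disjoint)) P₂₊ₜ₊ₖ~x
    }
    where
    1≤ℓ : 0 + 1 ≤ ℓ
    1≤ℓ = ≤-trans (s≤s z≤n) (≤-trans (m≤m+n (2 + t) k) bound)
    edge-xy : Path 1
    edge-xy = subpath P 0 1≤ℓ
    segment : Path k
    segment = subpath P (2 + t) bound
    y~segment : last edge-xy ~ first segment
    y~segment = subst (λ i → vertex P 1 ~ vertex P i) (sym (+-identityʳ (2 + t))) y~P₂₊ₜ
    disjoint : Disjoint edge-xy segment
    disjoint w∈xy w∈segment = visits-disjoint P (s≤s (s≤s z≤n)) bound
      (subpath-∈ P 0 1≤ℓ w∈xy) (subpath-∈ P (2 + t) bound w∈segment)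

  -- The cycle x P(2+s) P(1+s) … P 1 P b … P ℓ, closed by the edge P ℓ, P 0 of the cycle.
  chords⇒cycle₂ : (c : Cycle (suc ℓ)) (s b d : ℕ) → 2 + s < b → b + d ≡ ℓ →
    vertex (path c) 0 ~ vertex (path c) (2 + s) → vertex (path c) 1 ~ vertex (path c) b → Cycle (3 + (s + suc d))
  chords⇒cycle₂ {ℓ = ℓ} c s b d 2+s<b b+d≡ℓ x~P₂₊ₛ y~Pb = record
    { path    = join (singleton x) inner x~inner x∉inner
    ; closing = subst₂ _~_
        (sym (trans (join-last (singleton x) inner x~inner x∉inner)
                    (trans (join-last descent tail Pb~tail descent∩tail) (cong (vertex P) b+d≡ℓ))))
        (sym (join-first (singleton x) inner x~inner x∉inner))
        (closing c)
    }
    where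
    P : Path ℓ
    P = path c
    x : Vertex
    x = vertex P 0
    b+d≤ℓ : b + d ≤ ℓ
    b+d≤ℓ = ≤-reflexive b+d≡ℓ
    2+s≤ℓ : 1 + suc s ≤ ℓ
    2+s≤ℓ = ≤-trans (<⇒≤ 2+s<b) (≤-trans (m≤m+n b d) b+d≤ℓ)
    descent : Path (suc s)
    descent = reverse (subpath P 1 2+s≤ℓ)
    tail : Path d
    tail = subpath P b b+d≤ℓ
    Pb~tail : last descent ~ first tail
    Pb~tail = subst₂ _~_ (sym (reverse-last (subpath P 1 2+s≤ℓ))) (cong (vertex P) (sym (+-identityʳ b))) y~Pb
    descent-visits : ∀ {w} → w ∈ₚ descent → Visits P 1 (2 + s) w
    descent-visits = subpath-∈ P 1 2+s≤ℓ ∘ reverse-∈ (subpath P 1 2+s≤ℓ)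
    descent∩tail : Disjoint descent tail
    descent∩tail w∈descent w∈tail =
      visits-disjoint P 2+s<b b+d≤ℓ (descent-visits w∈descent) (subpath-∈ P b b+d≤ℓ w∈tail)
    inner : Path (suc s + suc d)
    inner = join descent tail Pb~tail descent∩tail
    x~inner : last (singleton x) ~ first inner
    x~inner = subst (x ~_) (sym (join-first descent tail Pb~tail descent∩tail)) x~P₂₊ₛ
    x∉inner : Disjoint (singleton x) inner
    x∉inner w∈x w∈inner with join-∈ descent tail Pb~tail descent∩tail w∈inner
    ... | inj₁ w∈descent = visits-disjoint P (s≤s z≤n) (<⇒≤ (<-≤-trans 2+s<b (≤-trans (m≤m+n b d) b+d≤ℓ)))
                             (0 , z≤n , z≤n , singleton-∈ w∈x) (descent-visits w∈descent)
    ... | inj₂ w∈tail = visits-disjoint P (<-trans (s≤s z≤n) 2+s<b) b+d≤ℓ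
                             (0 , z≤n , z≤n , singleton-∈ w∈x) (subpath-∈ P b b+d≤ℓ w∈tail)

  exit? : (P : Path ℓ) (v : Vertex) → Dec (∃ λ w → v ~ w × ¬ w ∈ₚ P)
  exit? P v = any? (λ w → (adj G v w ≟B true) ×-dec ¬? (w ∈ₚ? P))

  neighbours-on : (P : Path ℓ) → ∀ {v} → ¬ (∃ λ w → v ~ w × ¬ w ∈ₚ P) → ∀ w → v ~ w → w ∈ₚ P
  neighbours-on P no-exit w v~w = decidable-stable (w ∈ₚ? P) (no-exit ∘ (w ,_) ∘ (v~w ,_))

  outside? : (P : Path ℓ) → Dec (∃ λ w → ¬ w ∈ₚ P)
  outside? P = any? (λ w → ¬? (w ∈ₚ? P))

  no-outside⇒spanning : (P : Path ℓ) → ¬ (∃ λ w → ¬ w ∈ₚ P) → Spanning P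
  no-outside⇒spanning P none w = decidable-stable (w ∈ₚ? P) (none ∘ (w ,_))

  record HamiltonianCycle (L : ℕ) : Set where
    field
      cycle    : Cycle L
      spanning : Spanning (path cycle)
  open HamiltonianCycle public

  hamiltonian-length : ∀ {L} → HamiltonianCycle L → L ≡ M
  hamiltonian-length {zero}  H = ⊥-elim (~-irrefl (closing (cycle H)))
  hamiltonian-length {suc ℓ} H =
    ≤-antisym (length<M (path (cycle H))) (spanning⇒M≤ (path (cycle H)) (spanning H))

  -- Graphs of minimum degree more than half the order: Dirac and Bondy

  module Dense (δ : ℕ) (min-degree : ∀ v → δ ≤ count (adj G v)) (dense : M < δ + δ) where

    -- first P and last P have more than ℓ neighbours in total, all on P, so some first P ~ P (i + 1)
    -- and last P ~ P i cross.
    maximal-path⇒cycle : (P : Path ℓ) → (∀ w → first P ~ w → w ∈ₚ P) → (∀ w → last P ~ w → w ∈ₚ P) →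
      Cycle (suc ℓ) × δ ≤ ℓ
    maximal-path⇒cycle {ℓ = ℓ} P first-closed last-closed =
      close-at-crossing (common-true (X ∘ toℕ) (Y ∘ toℕ) crossing-count) , ≤-trans δ≤X (count≤ (X ∘ toℕ))
      where
      X Y : ℕ → Bool
      X i = adj G (first P) (vertex P (suc i))
      Y i = adj G (last P) (vertex P i)
      δ≤X : δ ≤ count< ℓ X
      δ≤X = ≤-trans (min-degree (first P)) (count-covered ℓ (adj G (first P)) (vertex P ∘ suc) cover)
        where
        cover : ∀ w → first P ~ w → ∃ λ i → i < ℓ × vertex P (suc i) ≡ w
        cover w x~w with first-closed w x~w
        ... | zero  , _   , refl = ⊥-elim (~-irrefl x~w)
        ... | suc i , i<ℓ , eq   = i , i<ℓ , eq
      δ≤Y : δ ≤ count< ℓ Y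
      δ≤Y = ≤-trans (min-degree (last P)) (count-covered ℓ (adj G (last P)) (vertex P) cover)
        where
        cover : ∀ w → last P ~ w → ∃ λ i → i < ℓ × vertex P i ≡ w
        cover w y~w with last-closed w y~w
        ... | k , k≤ℓ , eq with m≤n⇒m<n∨m≡n k≤ℓ
        ...   | inj₁ k<ℓ  = k , k<ℓ , eq
        ...   | inj₂ refl = ⊥-elim (~-irrefl (subst (last P ~_) (sym eq) y~w))
      crossing-count : ℓ < count< ℓ X + count< ℓ Y
      crossing-count = begin-strict
        ℓ                        <⟨ length<M P ⟩
        M                        <⟨ dense ⟩
        δ + δ                    ≤⟨ +-mono-≤ δ≤X δ≤Y ⟩
        count< ℓ X + count< ℓ Y  ∎
        where open ≤-Reasoning
      close-at-crossing : (∃ λ i → X (toℕ i) ≡ true × Y (toℕ i) ≡ true) → Cycle (suc ℓ)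
      close-at-crossing (i , x~Pi+1 , y~Pi) with (j , i+1+j≡ℓ) ← m≤n⇒∃[o]m+o≡n (toℕ<n i) =
        crossing⇒cycle P (toℕ i) j i+1+j≡ℓ (~-sym y~Pi) x~Pi+1

    has-neighbour-on : (P : Path ℓ) → δ ≤ ℓ → ∀ w → ∃ λ u → w ~ u × vertices P u ≡ true
    has-neighbour-on P δ≤ℓ w = common-true (adj G w) (vertices P) (begin-strict
      M                                   <⟨ dense ⟩
      δ + δ                               ≤⟨ +-mono-≤ (min-degree w) (≤-trans (m≤n⇒m≤1+n δ≤ℓ) (count-vertices P)) ⟩
      count (adj G w) + count (vertices P) ∎)
      where open ≤-Reasoning

    extend-through : (c : Cycle (suc ℓ)) → δ ≤ ℓ → ¬ w ∈ₚ path c → Path (suc ℓ)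
    extend-through {ℓ = ℓ} {w = w} c δ≤ℓ w∉c
      with (u , w~u , u∈c) ← has-neighbour-on (path c) δ≤ℓ w
      with (j , j≤ℓ , Pj≡u) ← vertices-sound (path c) u∈c
      with (Q , first-Q , Q⊆c) ← rotate c j j≤ℓ
      = extend-start Q (subst (w ~_) (sym (trans first-Q Pj≡u)) w~u) (w∉c ∘ Q⊆c)

    extend-or-hamiltonian : Cycle (suc ℓ) × δ ≤ ℓ → Path (suc ℓ) ⊎ ∃ HamiltonianCycle
    extend-or-hamiltonian (c , δ≤ℓ) with outside? (path c)
    ... | yes (w , w∉c) = inj₁ (extend-through c δ≤ℓ w∉c)
    ... | no  none      = inj₂ (_ , record { cycle = c ; spanning = no-outside⇒spanning (path c) none })

    longer-path-or-hamiltonian : Path ℓ → Path (suc ℓ) ⊎ ∃ HamiltonianCycle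
    longer-path-or-hamiltonian P with exit? P (last P) | exit? P (first P)
    ... | yes (w , last~w , w∉P) | _                          = inj₁ (extend-end P last~w w∉P)
    ... | no _                   | yes (w , first~w , w∉P)   = inj₁ (extend-start P (~-sym first~w) w∉P)
    ... | no last-closed         | no first-closed            =
      extend-or-hamiltonian (maximal-path⇒cycle P (neighbours-on P first-closed) (neighbours-on P last-closed))

    hamiltonian-from : ∀ k → k + ℓ ≡ M → Path ℓ → ∃ HamiltonianCycle
    hamiltonian-from zero    ℓ≡M P = ⊥-elim (<-irrefl ℓ≡M (length<M P))
    hamiltonian-from (suc k) k+1+ℓ≡M P with longer-path-or-hamiltonian P
    ... | inj₁ P′ = hamiltonian-from k (trans (+-suc k _) k+1+ℓ≡M) P′
    ... | inj₂ H  = H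

    hamiltonian : 0 < M → HamiltonianCycle M
    hamiltonian 0<M with (L , H) ← hamiltonian-from M (+-identityʳ M) (singleton (fromℕ< 0<M)) =
      subst HamiltonianCycle (hamiltonian-length H) H

    -- Bondy: x = h 0 and y = h 1 have more than k + r + 1 neighbours among h 2 … h (k + r + 2) in
    -- total. Comparing x ~ h (2 + s) with y ~ h (2 + r + 1 + s) for s < k, and x ~ h (2 + k + t) with
    -- y ~ h (2 + t) for t ≤ r, some pair of chords matches, and it closes a cycle of length 3 + k.
    shorter-cycle : ∀ k r → HamiltonianCycle (2 + (k + suc r)) → Cycle (3 + k)
    shorter-cycle k r H = [ chords-in-front , chords-behind ]
      (<-+-split (count< k X) (count< (suc r) (X ∘ (k +_))) (count< k (Y ∘ (suc r +_))) (count< (suc r) Y) split-count)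
      where
      P : Path (suc (k + suc r))
      P = path (cycle H)
      h : ℕ → Vertex
      h = vertex P
      X Y : ℕ → Bool
      X s = adj G (h 0) (h (2 + s))
      Y s = adj G (h 1) (h (2 + s))
      neighbours-beyond-two : ∀ v → adj G v (h 0) ≡ false ⊎ adj G v (h 1) ≡ false →
        δ ≤ 1 + count< (k + suc r) (λ s → adj G v (h (2 + s)))
      neighbours-beyond-two v not-both = begin
        δ                                                  ≤⟨ min-degree v ⟩
        count (adj G v)                                    ≤⟨ count-covered _ (adj G v) h cover ⟩
        count< (2 + (k + suc r)) (adj G v ∘ h)             ≤⟨ count<-drop-two (k + suc r) (adj G v ∘ h) not-both ⟩
        1 + count< (k + suc r) (λ s → adj G v (h (2 + s))) ∎
        where
        open ≤-Reasoning
        cover : ∀ w → v ~ w → ∃ λ i → i < 2 + (k + suc r) × h i ≡ w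
        cover w _ = Σ.map₂ (Σ.map₁ s≤s) (spanning H w)
      count-sum : k + suc r < count< (k + suc r) X + count< (k + suc r) Y
      count-sum = s<s⁻¹ (s<s⁻¹ (begin-strict
        2 + (k + suc r)                                              ≤⟨ length<M P ⟩
        M                                                            <⟨ dense ⟩
        δ + δ                                                        ≤⟨ +-mono-≤ (neighbours-beyond-two (h 0) (inj₁ (adj-irrefl G (h 0))))
                                                                                  (neighbours-beyond-two (h 1) (inj₂ (adj-irrefl G (h 1)))) ⟩
        (1 + count< (k + suc r) X) + (1 + count< (k + suc r) Y)      ≡⟨ cong suc (+-suc _ _) ⟩
        2 + (count< (k + suc r) X + count< (k + suc r) Y)            ∎))
        where open ≤-Reasoning
      split-count : k + suc r < (count< k X + count< (suc r) (X ∘ (k +_))) + (count< k (Y ∘ (suc r +_)) + count< (suc r) Y)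
      split-count = begin-strict
        k + suc r                                                    <⟨ count-sum ⟩
        count< (k + suc r) X + count< (k + suc r) Y                  ≡⟨ cong₂ _+_ (count<-+ k (suc r) X) (begin-equality
          count< (k + suc r) Y                                            ≡⟨ cong (λ n → count< n Y) (+-comm k (suc r)) ⟩
          count< (suc r + k) Y                                            ≡⟨ count<-+ (suc r) k Y ⟩
          count< (suc r) Y + count< k (Y ∘ (suc r +_))                    ≡⟨ +-comm (count< (suc r) Y) _ ⟩
          count< k (Y ∘ (suc r +_)) + count< (suc r) Y                    ∎) ⟩
        (count< k X + count< (suc r) (X ∘ (k +_))) + (count< k (Y ∘ (suc r +_)) + count< (suc r) Y) ∎
        where open ≤-Reasoning
      chords-behind : suc r < count< (suc r) (X ∘ (k +_)) + count< (suc r) Y → Cycle (3 + k)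
      chords-behind many with (t , x~h₂₊ₖ₊ₜ , y~h₂₊ₜ) ← common-true _ _ many =
        chords⇒cycle₁ P (toℕ t) k bound y~h₂₊ₜ
          (subst (λ i → h i ~ h 0) (cong (2 +_) (+-comm k (toℕ t))) (~-sym x~h₂₊ₖ₊ₜ))
        where
        bound : 2 + toℕ t + k ≤ suc (k + suc r)
        bound = ≤-trans (+-monoˡ-≤ k (s≤s (s≤s (s≤s⁻¹ (toℕ<n t))))) (≤-reflexive (cong suc (+-comm (suc r) k)))
      chords-in-front : k < count< k X + count< k (Y ∘ (suc r +_)) → Cycle (3 + k)
      chords-in-front many with (s , x~h₂₊ₛ , y~h₂₊ᵣ₊ₛ) ← common-true _ _ many
                           with (d , s+1+d≡k) ← m≤n⇒∃[o]m+o≡n (toℕ<n s) =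
        subst (Cycle ∘ (3 +_)) (trans (+-suc (toℕ s) d) s+1+d≡k)
          (chords⇒cycle₂ (cycle H) (toℕ s) (2 + (suc r + toℕ s)) d
            (s≤s (s≤s (m<n+m (toℕ s) (s≤s z≤n))))
            (trans (arithmetic r (toℕ s) d) (cong (λ n → suc (n + suc r)) s+1+d≡k))
            x~h₂₊ₛ y~h₂₊ᵣ₊ₛ)
        where
        arithmetic : ∀ r s d → 2 + (suc r + s) + d ≡ suc ((suc s + d) + suc r)
        arithmetic = solve-∀

    pancyclic : ∀ m → 3 ≤ m → m ≤ M → Cycle m
    pancyclic m 3≤m m≤M = from-hamiltonian (m≤n⇒∃[o]m+o≡n 3≤m) (m≤n⇒∃[o]m+o≡n m≤M) (hamiltonian 0<M)
      where
      0<M : 0 < M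
      0<M = ≤-trans (s≤s z≤n) (≤-trans 3≤m m≤M)
      from-hamiltonian : ∀ {m} → (∃ λ k → 3 + k ≡ m) → (∃ λ r → m + r ≡ M) → HamiltonianCycle M → Cycle m
      from-hamiltonian (k , refl) (r , m+r≡M) H =
        shorter-cycle k r (subst HamiltonianCycle (trans (sym m+r≡M) (cong (2 +_) (sym (+-suc k r)))) H)

full-degree⇒complement-pancyclic : ∀ {N n} (G : Graph N) (v : Fin N) → n + n < pred N →
  pred N ≤ degree G v → ¬ ContainsCopy (K2, n) (adj G) →
  ∀ m → 3 ≤ m → m ≤ pred N → ContainsCopy (C m) (complementAdj G)
full-degree⇒complement-pancyclic {suc N} {n} G v 2n<N N≤deg no-K m 3≤m m≤N =
  delete-copy v (complement G) (cycle⇒copy (pancyclic m 3≤m m≤N))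
  where
  universal : ∀ w → w ≢ v → adj G v w ≡ true
  universal = full-degree⇒adjacent-to-all G v (≤-trans N≤deg (≤-reflexive (degree≡count G v)))
  H : Graph N
  H = delete v (complement G)
  min-degree : ∀ u → N ∸ n ≤ count (adj H u)
  min-degree u = begin
    N ∸ n                                   ≤⟨ ∸-monoʳ-≤ N (K2,-free⇒low-degree G v universal no-K u′ (punchInᵢ≢i v u)) ⟩
    N ∸ count (adj G u′)                    ≡⟨ cong (_∸ count (adj G u′)) (count-adj+count-complement G u′) ⟨
    (count (adj G u′) + count (complementAdj G u′)) ∸ count (adj G u′)  ≡⟨ m+n∸m≡n (count (adj G u′)) _ ⟩
    count (complementAdj G u′)              ≡⟨ count-punchIn-false (complementAdj G u′) complement-u′v ⟩
    count (adj H u)                         ∎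
    where
    open ≤-Reasoning
    u′ : Fin (suc N)
    u′ = punchIn v u
    complement-u′v : complementAdj G u′ v ≡ false
    complement-u′v = cong (λ b → not b ∧ not ⌊ u′ ≟ v ⌋) (trans (adj-sym G u′ v) (universal u′ (punchInᵢ≢i v u)))
  dense : N < (N ∸ n) + (N ∸ n)
  dense = begin-strict
    N                   ≡⟨ m∸n+n≡m (m+n≤o⇒n≤o n (<⇒≤ 2n<N)) ⟨
    (N ∸ n) + n         <⟨ +-monoʳ-< (N ∸ n) (m+n≤o⇒m≤o∸n (suc n) 2n<N) ⟩
    (N ∸ n) + (N ∸ n)   ∎
    where open ≤-Reasoning
  open Paths H using (cycle⇒copy)
  open Paths.Dense H (N ∸ n) min-degree dense using (pancyclic)

mainTheorem7 : (n m : ℕ) → 1 ≤ n → 3 ≤ m → m ≤ 2 * n + 2 →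
    (G : Graph (2 * n + 3)) →
    ¬ ContainsCopy (K2, n) (adj G) →
    ¬ ContainsCopy (C m) (complementAdj G) →
    MaxDegreeLess G (2 * n + 2)
mainTheorem7 n m _ 3≤m m≤2n+2 G no-K no-C v with degree G v <? 2 * n + 2
... | yes small = small
... | no  large = contradiction
  (full-degree⇒complement-pancyclic G v
    (subst (n + n <_) (sym pred-vertices) (subst (λ k → n + k < 2 * n + 2) (+-identityʳ n) (m<m+n (2 * n) (s≤s z≤n))))
    (subst (_≤ degree G v) (sym pred-vertices) (≮⇒≥ large))
    no-K m 3≤m (subst (m ≤_) (sym pred-vertices) m≤2n+2))
  no-C
  where
  pred-vertices : pred (2 * n + 3) ≡ 2 * n + 2
  pred-vertices = cong pred (+-suc (2 * n) 2)
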